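{- Let $k,l$ be positive integers and let $C_6(k,l)$ be the graph with vertex set $(\{x_0,x_2,x_4\}\times\mathbb{Z}_k)\cup(\{x_1,x_3,x_5\}\times\mathbb{Z}_l)$ in which $(x_{2i},r)\sim(x_{2i\pm1},s)$ for every $i\in\{0,1,2\}$, $r\in\mathbb{Z}_k$, $s\in\mathbb{Z}_l$ (subscripts of $x$ modulo $6$), and there are no other edges. Then $C_6(k,l)$ is strongly distance-balanced if and only if $k=l$, while $d(u,W_{u,v})=d(v,W_{v,u})$ holds for every pair of adjacent vertices $u,v$ of $C_6(k,l)$.
   Context: $d$ denotes path-length distance; for a vertex $v$ and a vertex set $S$, $d(v,S)=\sum_{x\in S}d(v,x)$. For adjacent $u,v$, $W_{u,v}=\{x\mid d(x,u)<d(x,v)\}$ and $D^i_j(u,v)=\{x\mid d(u,x)=i,\ d(v,x)=j\}$. A graph is strongly distance-balanced if $|D^i_{i-1}(u,v)|=|D^{i-1}_i(u,v)|$ for every $i\ge1$ and every edge $uv$. -}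

module Defs where

open import Data.Nat using (ℕ; zero; suc; _+_; _∸_; _≤_)

open import Data.Bool using (Bool; true; false; _∧_; _∨_; if_then_else_)
open import Data.Fin using (Fin; zero; suc)
import Data.Fin.Properties as FinP
open import Data.List using (List; []; _∷_; length; map; concatMap; filter; allFin)
open import Data.Bool.ListAction using (any)
open import Data.Nat.ListAction using (sum)
open import Data.Product using (Σ; _,_; _×_)
open import Data.Product.Properties using (≡-dec)
open import Relation.Binary.Definitions using (DecidableEquality)
open import Relation.Nullary.Decidable using (⌊_⌋)
open import Relation.Binary.PropositionalEquality using (_≡_)

-- A finite (simple) graph, given by its vertex type, decidable equality,
-- the list of all its vertices (each exactly once) and a Boolean
-- adjacency relation.

record FinGraph : Set₁ where
  field
    V        : Set
    _≟V_     : DecidableEquality V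
    vertices : List V
    adj      : V → V → Bool

module _ (G : FinGraph) where
  open FinGraph G

  Adjacent : V → V → Set
  Adjacent u v = adj u v ≡ true

  reach : ℕ → V → V → Bool
  reach zero    u v = ⌊ u ≟V v ⌋
  reach (suc m) u v = reach m u v ∨ any (λ w → reach m u w ∧ adj w v) vertices

  -- path-length distance: least m with a walk of length ≤ m from u to v
  -- (search bounded by the number of vertices; irrelevant for connected graphs)
  private
    search : ℕ → ℕ → V → V → ℕ
    search zero    m u v = m
    search (suc f) m u v = if reach m u v then m else search f (suc m) u v

  dist : V → V → ℕ
  dist u v = search (length vertices) 0 u v

  W : V → V → List V
  W u v = filter (λ x → suc (dist x u) Data.Nat.≤? dist x v) vertices

  distToSet : V → List V → ℕ
  distToSet v S = sum (map (dist v) S)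

  Dcard : ℕ → ℕ → V → V → ℕ
  Dcard i j u v =
    length (filter (λ x → Data.Nat._≟_ (dist u x) i ×-dec Data.Nat._≟_ (dist v x) j) vertices)
    where open import Relation.Nullary.Decidable using (_×-dec_)

  StronglyDistanceBalanced : Set
  StronglyDistanceBalanced =
    ∀ (i : ℕ) → 1 ≤ i → ∀ (u v : V) → Adjacent u v →
      Dcard i (i ∸ 1) u v ≡ Dcard (i ∸ 1) i u v

-- The graph C₆(k,l).  Vertex (a , r) with a : Fin 6 stands for (x_a , r),
-- where r ∈ ℤ_k if a is even and r ∈ ℤ_l if a is odd.

next6 : Fin 6 → Fin 6
next6 zero = suc zero
next6 (suc zero) = suc (suc zero)
next6 (suc (suc zero)) = suc (suc (suc zero))
next6 (suc (suc (suc zero))) = suc (suc (suc (suc zero)))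
next6 (suc (suc (suc (suc zero)))) = suc (suc (suc (suc (suc zero))))
next6 (suc (suc (suc (suc (suc zero))))) = zero

isEven6 : Fin 6 → Bool
isEven6 zero = true
isEven6 (suc zero) = false
isEven6 (suc (suc zero)) = true
isEven6 (suc (suc (suc zero))) = false
isEven6 (suc (suc (suc (suc zero)))) = true
isEven6 (suc (suc (suc (suc (suc zero))))) = false

partSize : ℕ → ℕ → Fin 6 → ℕ
partSize k l a = if isEven6 a then k else l

C6V : ℕ → ℕ → Set
C6V k l = Σ (Fin 6) (λ a → Fin (partSize k l a))

C6 : ℕ → ℕ → FinGraph
C6 k l = record
  { V        = C6V k l
  ; _≟V_     = ≡-dec FinP._≟_ FinP._≟_
  ; vertices = concatMap (λ a → map (a ,_) (allFin (partSize k l a))) (allFin 6)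
  ; adj      = λ { (a , _) (b , _) → ⌊ b FinP.≟ next6 a ⌋ ∨ ⌊ a FinP.≟ next6 b ⌋ }
  }

{-# OPTIONS --safe #-}
-- C₆(k,l) blows every vertex of a hexagon up into an independent set, so two distinct
-- vertices in parts a and b are at the cycle distance of a and b, or at distance 2 when
-- a = b.  Hence, for an edge uv and any ψ, the sum of ψ(d(u,x), d(v,x)) over all
-- vertices x is an affine function of k and l whose coefficients depend only on the
-- parts of u and v.  Both |D^i_j(u,v)| and d(u, W_{u,v}) are such sums, and all
-- distances are at most 3, so both claims reduce to comparing finitely many coefficient
-- triples, which is done by computation.  For k ≠ l the edge x₀x₁ already fails:
-- |D²₁| = 2k − 1 while |D¹₂| = 2l − 1.
module Submission where

open import Defs
open import Data.Nat using (ℕ; _≤_)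
open import Data.Product using (_×_)
open import Function.Bundles using (_⇔_)
open import Relation.Binary.PropositionalEquality using (_≡_)

open import Data.Bool using (Bool; true; false; T; _∧_; _∨_; if_then_else_)
open import Data.Bool.ListAction using (any; or)
open import Data.Bool.Properties using (T-∧; T-∨; T-≡)
import Data.Bool.Properties as Bool
open import Data.Empty using (⊥-elim)
open import Data.Fin using (Fin; zero; suc; toℕ)
open import Data.Fin.Patterns using (0F; 1F; 2F; 3F; 4F; 5F)
import Data.Fin.Properties as Fin
open import Data.List using (List; []; _∷_; _++_; length; map; concatMap; filter; tabulate; allFin)
open import Data.List.Membership.Propositional using (_∈_; lose)
open import Data.List.Membership.Propositional.Properties using (∈-allFin; ∈-map⁺; ∈-concatMap⁺)
open import Data.List.Properties using (map-++; map-cong; map-∘; map-tabulate; length-++; length-map; length-tabulate; filter-none)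
open import Data.List.Relation.Unary.All as All using ()
open import Data.List.Relation.Unary.Any as Any using ()
open import Data.List.Relation.Unary.Any.Properties using (any⁺; any⁻)
open import Data.Nat using (zero; suc; _+_; _*_; _∸_; _⊓_; ∣_-_∣; _<_; _≤ᵇ_; _≤?_; _≟_; z≤n; s≤s)
open import Data.Nat.ListAction using (sum)
open import Data.Nat.ListAction.Properties using (sum-++)
open import Data.Nat.Tactic.RingSolver using (solve-∀)
open import Data.Nat.Properties
  using (≤-refl; ≤-trans; m≤m+n; suc-injective; <⇒≱; *-cancelˡ-≡; +-identityʳ; *-distribʳ-+; m≤n⇒m≤1+n; m≤n⇒m<n∨m≡n; m<1+n⇒m≤n; ≤ᵇ⇒≤; ≤⇒≤ᵇ; ≤-reflexive; +-mono-≤; +-comm; +-assoc)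
open import Data.Product using (∃-syntax; _,_; proj₁; proj₂)
open import Data.Product.Properties using (,-injectiveʳ-UIP; ≡-dec)
open import Axiom.UniquenessOfIdentityProofs using (module Decidable⇒UIP)
open import Data.Sum using (_⊎_; inj₁; inj₂)
open import Function using (_∘_; id)
open import Function.Bundles using (Equivalence; mk⇔)
open import Relation.Binary.PropositionalEquality using (refl; sym; trans; cong; cong₂; subst; _≢_; module ≡-Reasoning)
open import Relation.Nullary using (¬_; yes; no; does)
open import Relation.Nullary.Decidable using (⌊_⌋; _×-dec_; _⊎-dec_; _→-dec_; ¬?; from-yes)
open import Relation.Unary using (Decidable)
open import Relation.Binary.Definitions using (DecidableEquality)

open Equivalence using (to; from)

T⇔T⇒≡ : ∀ {x y} → (T x → T y) → (T y → T x) → x ≡ y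
T⇔T⇒≡ {false} {false} _ _ = refl
T⇔T⇒≡ {false} {true}  _ g = ⊥-elim (g _)
T⇔T⇒≡ {true}  {false} f _ = ⊥-elim (f _)
T⇔T⇒≡ {true}  {true}  _ _ = refl

if-true : ∀ {A : Set} {b} {x y : A} → b ≡ true → (if b then x else y) ≡ x
if-true refl = refl

if-false : ∀ {A : Set} {b} {x y : A} → b ≡ false → (if b then x else y) ≡ y
if-false refl = refl

module _ {A : Set} {P : A → Set} (P? : Decidable P) where

  length-filter≡sum : ∀ xs → length (filter P? xs) ≡ sum (map (λ x → if does (P? x) then 1 else 0) xs)
  length-filter≡sum []       = refl
  length-filter≡sum (x ∷ xs) with does (P? x)
  ... | true  = cong suc (length-filter≡sum xs)
  ... | false = length-filter≡sum xs

  sum-map-filter : ∀ (f : A → ℕ) xs →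
                   sum (map f (filter P? xs)) ≡ sum (map (λ x → if does (P? x) then f x else 0) xs)
  sum-map-filter f []       = refl
  sum-map-filter f (x ∷ xs) with does (P? x)
  ... | true  = cong (f x +_) (sum-map-filter f xs)
  ... | false = sum-map-filter f xs

sum-map-concatMap : ∀ {A B : Set} (f : B → ℕ) (g : A → List B) xs →
                    sum (map f (concatMap g xs)) ≡ sum (map (λ x → sum (map f (g x))) xs)
sum-map-concatMap f g []       = refl
sum-map-concatMap f g (x ∷ xs) = begin
  sum (map f (g x ++ concatMap g xs))               ≡⟨ cong sum (map-++ f (g x) _) ⟩
  sum (map f (g x) ++ map f (concatMap g xs))       ≡⟨ sum-++ (map f (g x)) _ ⟩
  sum (map f (g x)) + sum (map f (concatMap g xs))  ≡⟨ cong (_ +_) (sum-map-concatMap f g xs) ⟩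
  sum (map f (g x)) + sum (map (λ y → sum (map f (g y))) xs) ∎
  where open ≡-Reasoning

length≤length-concatMap : ∀ {A B : Set} (g : A → List B) → (∀ x → 1 ≤ length (g x)) →
                          ∀ xs → length xs ≤ length (concatMap g xs)
length≤length-concatMap g nonempty []       = z≤n
length≤length-concatMap g nonempty (x ∷ xs) = ≤-trans
  (+-mono-≤ (nonempty x) (length≤length-concatMap g nonempty xs))
  (≤-reflexive (sym (length-++ (g x))))

sum-tabulate-const : ∀ {n} (g : Fin n → ℕ) {y} → (∀ t → g t ≡ y) → sum (tabulate g) ≡ n * y
sum-tabulate-const {zero}  g g≡y = refl
sum-tabulate-const {suc n} g g≡y = cong₂ _+_ (g≡y zero) (sum-tabulate-const (g ∘ suc) (g≡y ∘ suc))

sum-tabulate-except : ∀ {n} (g : Fin n → ℕ) (t₀ : Fin n) {y} → (∀ t → t ≢ t₀ → g t ≡ y) →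
                      sum (tabulate g) ≡ g t₀ + (n ∸ 1) * y
sum-tabulate-except g zero g≡y =
  cong (g zero +_) (sum-tabulate-const (g ∘ suc) (λ t → g≡y (suc t) λ ()))
sum-tabulate-except {suc (suc n)} g (suc t₀) {y} g≡y = begin
  g zero + sum (tabulate (g ∘ suc))  ≡⟨ cong₂ _+_ (g≡y zero λ ()) (sum-tabulate-except (g ∘ suc) t₀ g∘suc≡y) ⟩
  y + (g (suc t₀) + n * y)           ≡⟨ sym (+-assoc y _ _) ⟩
  y + g (suc t₀) + n * y             ≡⟨ cong (_+ n * y) (+-comm y _) ⟩
  g (suc t₀) + y + n * y             ≡⟨ +-assoc (g (suc t₀)) y _ ⟩
  g (suc t₀) + (y + n * y)           ∎
  where
  open ≡-Reasoning
  g∘suc≡y : ∀ t → t ≢ t₀ → g (suc t) ≡ y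
  g∘suc≡y t t≢t₀ = g≡y (suc t) (t≢t₀ ∘ Fin.suc-injective)

-- `dist` is a bounded search through a private helper, so it can only be
-- evaluated by unfolding it on an explicit vertex list; four steps of the
-- search decide every distance up to 3.
dist-from-reach : (G : FinGraph) (let open FinGraph G) → 4 ≤ length vertices →
                  (D : V → V → ℕ) → (∀ m u v → reach G m u v ≡ (D u v ≤ᵇ m)) →
                  ∀ u v → D u v ≤ 3 → dist G u v ≡ D u v
dist-from-reach record { vertices = _ ∷ _ ∷ _ ∷ _ ∷ _ } _ D reach≡ u v D≤3
  with D u v | D≤3 | reach≡ 0 u v | reach≡ 1 u v | reach≡ 2 u v | reach≡ 3 u v
... | 0 | _ | r₀ | _  | _  | _  = if-true r₀
... | 1 | _ | r₀ | r₁ | _  | _  = trans (if-false r₀) (if-true r₁)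
... | 2 | _ | r₀ | r₁ | r₂ | _  = trans (if-false r₀) (trans (if-false r₁) (if-true r₂))
... | 3 | _ | r₀ | r₁ | r₂ | r₃ = trans (if-false r₀) (trans (if-false r₁) (trans (if-false r₂) (if-true r₃)))
... | suc (suc (suc (suc _))) | s≤s (s≤s (s≤s ())) | _ | _ | _ | _
dist-from-reach record { vertices = [] }                    ()
dist-from-reach record { vertices = _ ∷ [] }                (s≤s ())
dist-from-reach record { vertices = _ ∷ _ ∷ [] }            (s≤s (s≤s ()))
dist-from-reach record { vertices = _ ∷ _ ∷ _ ∷ [] }        (s≤s (s≤s (s≤s ())))

module WalkDistance
  (G : FinGraph)
  (complete : ∀ v → v ∈ FinGraph.vertices G)
  (D : FinGraph.V G → FinGraph.V G → ℕ)
  (D-refl : ∀ u → D u u ≡ 0)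
  (D≡0⇒≡ : ∀ u v → D u v ≡ 0 → u ≡ v)
  (D-adj : ∀ u v w → Adjacent G w v → D u v ≤ suc (D u w))
  (D-pred : ∀ u v m → D u v ≡ suc m → ∃[ w ] Adjacent G w v × D u w ≤ m)
  where

  open FinGraph G

  reach≡≤ᵇ : ∀ m u v → reach G m u v ≡ (D u v ≤ᵇ m)
  reach≡≤ᵇ zero u v with u ≟V v
  ... | yes refl = cong (_≤ᵇ 0) (sym (D-refl u))
  ... | no u≢v with D u v in eq
  ...   | zero  = ⊥-elim (u≢v (D≡0⇒≡ u v eq))
  ...   | suc _ = refl
  reach≡≤ᵇ (suc m) u v = begin
    reach G m u v ∨ any (λ w → reach G m u w ∧ adj w v) vertices
      ≡⟨ cong₂ _∨_ (reach≡≤ᵇ m u v) (cong or (map-cong (λ w → cong (_∧ adj w v) (reach≡≤ᵇ m u w)) vertices)) ⟩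
    (D u v ≤ᵇ m) ∨ any near vertices
      ≡⟨ T⇔T⇒≡ step unstep ⟩
    (D u v ≤ᵇ suc m) ∎
    where
    open ≡-Reasoning
    near : V → Bool
    near w = (D u w ≤ᵇ m) ∧ adj w v

    step : T ((D u v ≤ᵇ m) ∨ any near vertices) → T (D u v ≤ᵇ suc m)
    step h with to T-∨ h
    ... | inj₁ Duv≤m = ≤⇒≤ᵇ (m≤n⇒m≤1+n (≤ᵇ⇒≤ (D u v) m Duv≤m))
    ... | inj₂ some with Any.satisfied (any⁻ near vertices some)
    ...   | w , w-near with to T-∧ w-near
    ...     | Duw≤m , w~v = ≤⇒≤ᵇ (≤-trans (D-adj u v w (to T-≡ w~v)) (s≤s (≤ᵇ⇒≤ _ _ Duw≤m)))

    unstep : T (D u v ≤ᵇ suc m) → T ((D u v ≤ᵇ m) ∨ any near vertices)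
    unstep h with m≤n⇒m<n∨m≡n (≤ᵇ⇒≤ _ _ h)
    ... | inj₁ Duv<1+m = from T-∨ (inj₁ (≤⇒≤ᵇ (m<1+n⇒m≤n Duv<1+m)))
    ... | inj₂ Duv≡1+m with D-pred u v m Duv≡1+m
    ...   | w , w~v , Duw≤m =
      from T-∨ (inj₂ (any⁺ near (lose (complete w) (from T-∧ (≤⇒≤ᵇ Duw≤m , from T-≡ w~v)))))

  dist≡ : 4 ≤ length vertices → (∀ u v → D u v ≤ 3) → ∀ u v → dist G u v ≡ D u v
  dist≡ 4≤n D≤3 u v = dist-from-reach G 4≤n D reach≡≤ᵇ u v (D≤3 u v)

layerIndicator : ℕ → ℕ → ℕ → ℕ → ℕ
layerIndicator i j p q = if does ((p ≟ i) ×-dec (q ≟ j)) then 1 else 0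

closerDist : ℕ → ℕ → ℕ
closerDist p q = if does (suc p ≤? q) then p else 0

module _ (G : FinGraph) where

  open FinGraph G

  Dcard≡sum : ∀ i j u v →
              Dcard G i j u v ≡ sum (map (λ x → layerIndicator i j (dist G u x) (dist G v x)) vertices)
  Dcard≡sum i j u v = length-filter≡sum _ vertices

  Dcard≡0 : ∀ i j u v → (∀ x → ¬ (dist G u x ≡ i × dist G v x ≡ j)) → Dcard G i j u v ≡ 0
  Dcard≡0 i j u v nowhere = cong length (filter-none _ (All.universal nowhere vertices))

  distToSet-W≡sum : (∀ x y → dist G x y ≡ dist G y x) → ∀ u v →
                    distToSet G u (W G u v) ≡ sum (map (λ x → closerDist (dist G u x) (dist G v x)) vertices)
  distToSet-W≡sum dist-sym u v = trans (sum-map-filter _ (dist G u) vertices) (cong sum (map-cong closer vertices))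
    where
    closer : ∀ x → (if does (suc (dist G x u) ≤? dist G x v) then dist G u x else 0)
                   ≡ closerDist (dist G u x) (dist G v x)
    closer x = cong₂ (λ p q → if does (suc p ≤? q) then dist G u x else 0) (dist-sym x u) (dist-sym x v)

cycleAdj : Fin 6 → Fin 6 → Bool
cycleAdj a b = ⌊ b Fin.≟ next6 a ⌋ ∨ ⌊ a Fin.≟ next6 b ⌋

cycleAdj-sym : ∀ a b → cycleAdj a b ≡ cycleAdj b a
cycleAdj-sym a b = Bool.∨-comm ⌊ b Fin.≟ next6 a ⌋ ⌊ a Fin.≟ next6 b ⌋

cycleDist : Fin 6 → Fin 6 → ℕ
cycleDist a b = ∣ toℕ a - toℕ b ∣ ⊓ (6 ∸ ∣ toℕ a - toℕ b ∣)

-- the distance between two distinct vertices of C₆(k,l) lying in the parts a and b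
partDist : Fin 6 → Fin 6 → ℕ
partDist a b = if does (a Fin.≟ b) then 2 else cycleDist a b

partDist-≢ : ∀ {a b} → a ≢ b → partDist a b ≡ cycleDist a b
partDist-≢ {a} {b} a≢b with a Fin.≟ b
... | yes a≡b = ⊥-elim (a≢b a≡b)
... | no _    = refl

cycleDist-refl : ∀ a → cycleDist a a ≡ 0
cycleDist-refl = from-yes (Fin.all? λ a → cycleDist a a ≟ 0)

partDist-sym : ∀ a b → partDist a b ≡ partDist b a
partDist-sym = from-yes (Fin.all? λ a → Fin.all? λ b → partDist a b ≟ partDist b a)

partDist-bounds : ∀ a b → 1 ≤ partDist a b × partDist a b ≤ 3
partDist-bounds = from-yes (Fin.all? λ a → Fin.all? λ b → (1 ≤? partDist a b) ×-dec (partDist a b ≤? 3))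

cycleAdj-irrefl : ∀ a b → cycleAdj a b ≡ true → a ≢ b
cycleAdj-irrefl = from-yes (Fin.all? λ a → Fin.all? λ b → (cycleAdj a b Bool.≟ true) →-dec ¬? (a Fin.≟ b))

cycleAdj⇒partDist≡1 : ∀ a b → cycleAdj a b ≡ true → partDist a b ≡ 1
cycleAdj⇒partDist≡1 = from-yes (Fin.all? λ a → Fin.all? λ b → (cycleAdj a b Bool.≟ true) →-dec (partDist a b ≟ 1))

partDist-triangle : ∀ a b c → cycleAdj c b ≡ true → partDist a b ≤ suc (partDist a c)
partDist-triangle = from-yes (Fin.all? λ a → Fin.all? λ b → Fin.all? λ c →
  (cycleAdj c b Bool.≟ true) →-dec (partDist a b ≤? suc (partDist a c)))

partDist-pred : ∀ a b → cycleAdj a b ≡ true ⊎ ∃[ c ] cycleAdj c b ≡ true × suc (partDist a c) ≡ partDist a b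
partDist-pred = from-yes (Fin.all? λ a → Fin.all? λ b → (cycleAdj a b Bool.≟ true) ⊎-dec
  Fin.any? (λ c → (cycleAdj c b Bool.≟ true) ×-dec (suc (partDist a c) ≟ partDist a b)))

Weights : Set
Weights = ℕ × ℕ × ℕ

evalWeights : ℕ → ℕ → Weights → ℕ
evalWeights m n (c , cₘ , cₙ) = c + cₘ * m + cₙ * n

-- The coefficients (c , cₘ , cₙ) of  Σₓ ψ(d(u,x), d(v,x)) = c + cₘ (k − 1) + cₙ (l − 1)
-- for an edge uv from part a to part b: one vertex per part, u and v among them, spans
-- a hexagon with cycle distances, and each of the k − 1 (resp. l − 1) other vertices of
-- an even (resp. odd) part c is at distances partDist a c and partDist b c from u and v.
weights : (ℕ → ℕ → ℕ) → Fin 6 → Fin 6 → Weights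
weights ψ a b = sum (map (λ c → ψ (cycleDist a c) (cycleDist b c)) (allFin 6))
              , off 0F + off 2F + off 4F
              , off 1F + off 3F + off 5F
  where
  off : Fin 6 → ℕ
  off c = ψ (partDist a c) (partDist b c)

sum-parts≡evalWeights : ∀ (h o : Fin 6 → ℕ) m n →
  sum (map (λ c → h c + (partSize (suc m) (suc n) c ∸ 1) * o c) (allFin 6))
    ≡ evalWeights m n (sum (map h (allFin 6)) , o 0F + o 2F + o 4F , o 1F + o 3F + o 5F)
sum-parts≡evalWeights h o m n =
  regroup (h 0F) (h 1F) (h 2F) (h 3F) (h 4F) (h 5F) (o 0F) (o 1F) (o 2F) (o 3F) (o 4F) (o 5F) m n
  where
  regroup : ∀ h₀ h₁ h₂ h₃ h₄ h₅ o₀ o₁ o₂ o₃ o₄ o₅ m n →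
    h₀ + m * o₀ + (h₁ + n * o₁ + (h₂ + m * o₂ + (h₃ + n * o₃ + (h₄ + m * o₄ + (h₅ + n * o₅ + 0)))))
    ≡ h₀ + (h₁ + (h₂ + (h₃ + (h₄ + (h₅ + 0))))) + (o₀ + o₂ + o₄) * m + (o₁ + o₃ + o₅) * n
  regroup = solve-∀

diagonal : Weights → ℕ × ℕ
diagonal (c , cₘ , cₙ) = c , cₘ + cₙ

diagonal-≡⇒evalWeights-≡ : ∀ m w w′ → diagonal w ≡ diagonal w′ → evalWeights m m w ≡ evalWeights m m w′
diagonal-≡⇒evalWeights-≡ m (c , cₘ , cₙ) (c′ , cₘ′ , cₙ′) eq = begin
  c + cₘ * m + cₙ * m       ≡⟨ +-assoc c _ _ ⟩
  c + (cₘ * m + cₙ * m)     ≡⟨ cong (c +_) (*-distribʳ-+ m cₘ cₙ) ⟨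
  c + (cₘ + cₙ) * m         ≡⟨ cong (λ (d , e) → d + e * m) eq ⟩
  c′ + (cₘ′ + cₙ′) * m      ≡⟨ cong (c′ +_) (*-distribʳ-+ m cₘ′ cₙ′) ⟩
  c′ + (cₘ′ * m + cₙ′ * m)  ≡⟨ +-assoc c′ _ _ ⟨
  c′ + cₘ′ * m + cₙ′ * m    ∎
  where open ≡-Reasoning

_≟ʷ_ : DecidableEquality Weights
_≟ʷ_ = ≡-dec _≟_ (≡-dec _≟_ _≟_)

closerWeights-sym : ∀ a b → cycleAdj a b ≡ true → weights closerDist a b ≡ weights closerDist b a
closerWeights-sym = from-yes (Fin.all? λ a → Fin.all? λ b →
  (cycleAdj a b Bool.≟ true) →-dec (weights closerDist a b ≟ʷ weights closerDist b a))

LayersBalancedAt : ℕ → Set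
LayersBalancedAt i = ∀ a b → cycleAdj a b ≡ true →
  diagonal (weights (layerIndicator i (i ∸ 1)) a b) ≡ diagonal (weights (layerIndicator (i ∸ 1) i) a b)

layersBalanced : ∀ (i : Fin 4) → LayersBalancedAt (toℕ i)
layersBalanced = from-yes (Fin.all? λ (i : Fin 4) → Fin.all? λ a → Fin.all? λ b →
  (cycleAdj a b Bool.≟ true) →-dec ≡-dec _≟_ _≟_
    (diagonal (weights (layerIndicator (toℕ i) (toℕ i ∸ 1)) a b))
    (diagonal (weights (layerIndicator (toℕ i ∸ 1) (toℕ i)) a b)))

module Blowup (k′ l′ : ℕ) where

  G : FinGraph
  G = C6 (suc k′) (suc l′)

  open FinGraph G using (V; _≟V_; vertices)

  size : Fin 6 → ℕ
  size = partSize (suc k′) (suc l′)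

  anchor : ∀ c → Fin (size c)
  anchor c with isEven6 c
  ... | true  = zero
  ... | false = zero

  part : ∀ c → List V
  part c = map (c ,_) (allFin (size c))

  complete : ∀ v → v ∈ vertices
  complete (a , r) = ∈-concatMap⁺ part (lose (∈-allFin a) (∈-map⁺ (a ,_) (∈-allFin r)))

  4≤|vertices| : 4 ≤ length vertices
  4≤|vertices| = ≤-trans (m≤m+n 4 2) (length≤length-concatMap part part-nonempty (allFin 6))
    where
    part-nonempty : ∀ c → 1 ≤ length (part c)
    part-nonempty c = subst (1 ≤_) (sym (trans (length-map _ (allFin (size c))) (length-tabulate id)))
                            (≤-trans (s≤s z≤n) (Fin.toℕ<n (anchor c)))

  vertexDist : V → V → ℕ
  vertexDist u v = if does (u ≟V v) then 0 else partDist (proj₁ u) (proj₁ v)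

  vertexDist-refl : ∀ u → vertexDist u u ≡ 0
  vertexDist-refl u with u ≟V u
  ... | yes _   = refl
  ... | no u≢u = ⊥-elim (u≢u refl)

  vertexDist-≢ : ∀ {u v} → u ≢ v → vertexDist u v ≡ partDist (proj₁ u) (proj₁ v)
  vertexDist-≢ {u} {v} u≢v with u ≟V v
  ... | yes u≡v = ⊥-elim (u≢v u≡v)
  ... | no _    = refl

  vertexDist≤partDist : ∀ u v → vertexDist u v ≤ partDist (proj₁ u) (proj₁ v)
  vertexDist≤partDist u v with u ≟V v
  ... | yes _ = z≤n
  ... | no _  = ≤-refl

  vertexDist≤3 : ∀ u v → vertexDist u v ≤ 3
  vertexDist≤3 u v = ≤-trans (vertexDist≤partDist u v) (proj₂ (partDist-bounds (proj₁ u) (proj₁ v)))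

  vertexDist≡0⇒≡ : ∀ u v → vertexDist u v ≡ 0 → u ≡ v
  vertexDist≡0⇒≡ u v eq with u ≟V v
  ... | yes u≡v = u≡v
  ... | no _ with () ← subst (1 ≤_) eq (proj₁ (partDist-bounds (proj₁ u) (proj₁ v)))

  vertexDist-sym : ∀ u v → vertexDist u v ≡ vertexDist v u
  vertexDist-sym u v with u ≟V v | v ≟V u
  ... | yes _   | yes _   = refl
  ... | yes u≡v | no v≢u = ⊥-elim (v≢u (sym u≡v))
  ... | no u≢v  | yes v≡u = ⊥-elim (u≢v (sym v≡u))
  ... | no _    | no _    = partDist-sym (proj₁ u) (proj₁ v)

  vertexDist-adj : ∀ u v w → Adjacent G w v → vertexDist u v ≤ suc (vertexDist u w)
  vertexDist-adj u v w w~v with u ≟V w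
  ... | yes refl = ≤-trans (vertexDist≤partDist u v)
                           (≤-reflexive (cycleAdj⇒partDist≡1 (proj₁ w) (proj₁ v) w~v))
  ... | no _     = ≤-trans (vertexDist≤partDist u v)
                           (partDist-triangle (proj₁ u) (proj₁ v) (proj₁ w) w~v)

  vertexDist-pred : ∀ u v m → vertexDist u v ≡ suc m → ∃[ w ] Adjacent G w v × vertexDist u w ≤ m
  vertexDist-pred u v m eq with u ≟V v | partDist-pred (proj₁ u) (proj₁ v)
  ... | yes _ | _ with () ← eq
  ... | no _  | inj₁ u~v = u , u~v , subst (_≤ m) (sym (vertexDist-refl u)) z≤n
  ... | no _  | inj₂ (c , c~v , pred) =
    (c , anchor c) , c~v ,
    ≤-trans (vertexDist≤partDist u (c , anchor c)) (≤-reflexive (suc-injective (trans pred eq)))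

  open WalkDistance G complete vertexDist
    vertexDist-refl vertexDist≡0⇒≡ vertexDist-adj vertexDist-pred

  dist≡vertexDist : ∀ u v → dist G u v ≡ vertexDist u v
  dist≡vertexDist = dist≡ 4≤|vertices| vertexDist≤3

  ,-injectiveʳ-V : ∀ {c} {t t′ : Fin (size c)} → _≡_ {A = V} (c , t) (c , t′) → t ≡ t′
  ,-injectiveʳ-V = ,-injectiveʳ-UIP (Decidable⇒UIP.≡-irrelevant Fin._≟_)

  vertexDist≡cycleDist : ∀ u x → u ≡ x ⊎ proj₁ u ≢ proj₁ x → vertexDist u x ≡ cycleDist (proj₁ u) (proj₁ x)
  vertexDist≡cycleDist u .u (inj₁ refl) = trans (vertexDist-refl u) (sym (cycleDist-refl (proj₁ u)))
  vertexDist≡cycleDist u x  (inj₂ a≢c)  = trans (vertexDist-≢ (a≢c ∘ cong proj₁)) (partDist-≢ a≢c)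

  partContribution : (ℕ → ℕ → ℕ) → Fin 6 → Fin 6 → Fin 6 → ℕ
  partContribution ψ a b c = ψ (cycleDist a c) (cycleDist b c) + (size c ∸ 1) * ψ (partDist a c) (partDist b c)

  module _ (ψ : ℕ → ℕ → ℕ) (u v : V) where

    part-sum-around : ∀ c (t₀ : Fin (size c)) → (∀ t → t ≢ t₀ → (c , t) ≢ u × (c , t) ≢ v) →
      u ≡ (c , t₀) ⊎ proj₁ u ≢ c → v ≡ (c , t₀) ⊎ proj₁ v ≢ c →
      sum (tabulate (λ t → ψ (vertexDist u (c , t)) (vertexDist v (c , t)))) ≡ partContribution ψ (proj₁ u) (proj₁ v) c
    part-sum-around c t₀ others u-at v-at = trans
      (sum-tabulate-except _ t₀ λ t t≢t₀ →
        cong₂ ψ (vertexDist-≢ (proj₁ (others t t≢t₀) ∘ sym)) (vertexDist-≢ (proj₂ (others t t≢t₀) ∘ sym)))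
      (cong₂ _+_ (cong₂ ψ (vertexDist≡cycleDist u _ u-at) (vertexDist≡cycleDist v _ v-at)) refl)

    part-sum : proj₁ u ≢ proj₁ v → ∀ c →
      sum (tabulate (λ t → ψ (vertexDist u (c , t)) (vertexDist v (c , t)))) ≡ partContribution ψ (proj₁ u) (proj₁ v) c
    part-sum a≢b c with c Fin.≟ proj₁ u | c Fin.≟ proj₁ v
    ... | yes refl | _        = part-sum-around c (proj₂ u)
      (λ t t≢r → t≢r ∘ ,-injectiveʳ-V , a≢b ∘ cong proj₁) (inj₁ refl) (inj₂ (a≢b ∘ sym))
    ... | no c≢a   | yes refl = part-sum-around c (proj₂ v)
      (λ t t≢s → c≢a ∘ cong proj₁ , t≢s ∘ ,-injectiveʳ-V) (inj₂ a≢b) (inj₁ refl)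
    ... | no c≢a   | no c≢b   = part-sum-around c (anchor c)
      (λ t _ → c≢a ∘ cong proj₁ , c≢b ∘ cong proj₁) (inj₂ (c≢a ∘ sym)) (inj₂ (c≢b ∘ sym))

    sum-over-vertices : proj₁ u ≢ proj₁ v →
      sum (map (λ x → ψ (vertexDist u x) (vertexDist v x)) vertices) ≡ evalWeights k′ l′ (weights ψ (proj₁ u) (proj₁ v))
    sum-over-vertices a≢b = begin
      sum (map f (concatMap part (allFin 6)))           ≡⟨ sum-map-concatMap f part (allFin 6) ⟩
      sum (map (λ c → sum (map f (part c))) (allFin 6)) ≡⟨ cong sum (map-cong per-part (allFin 6)) ⟩
      sum (map (partContribution ψ a b) (allFin 6))
        ≡⟨ sum-parts≡evalWeights (λ c → ψ (cycleDist a c) (cycleDist b c)) (λ c → ψ (partDist a c) (partDist b c)) k′ l′ ⟩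
      evalWeights k′ l′ (weights ψ a b)                ∎
      where
      open ≡-Reasoning
      a = proj₁ u
      b = proj₁ v
      f : V → ℕ
      f x = ψ (vertexDist u x) (vertexDist v x)
      per-part : ∀ c → sum (map f (part c)) ≡ partContribution ψ a b c
      per-part c = trans (cong sum (trans (sym (map-∘ (allFin (size c)))) (map-tabulate id (f ∘ (c ,_)))))
                         (part-sum a≢b c)

  dist≤3 : ∀ u v → dist G u v ≤ 3
  dist≤3 u v = subst (_≤ 3) (sym (dist≡vertexDist u v)) (vertexDist≤3 u v)

  dist-sym : ∀ u v → dist G u v ≡ dist G v u
  dist-sym u v = trans (dist≡vertexDist u v) (trans (vertexDist-sym u v) (sym (dist≡vertexDist v u)))

  sum-dist≡evalWeights : ∀ (ψ : ℕ → ℕ → ℕ) u v → Adjacent G u v →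
    sum (map (λ x → ψ (dist G u x) (dist G v x)) vertices) ≡ evalWeights k′ l′ (weights ψ (proj₁ u) (proj₁ v))
  sum-dist≡evalWeights ψ u v u~v = trans
    (cong sum (map-cong (λ x → cong₂ ψ (dist≡vertexDist u x) (dist≡vertexDist v x)) vertices))
    (sum-over-vertices ψ u v (cycleAdj-irrefl (proj₁ u) (proj₁ v) u~v))

  Dcard≡evalWeights : ∀ i j u v → Adjacent G u v →
    Dcard G i j u v ≡ evalWeights k′ l′ (weights (layerIndicator i j) (proj₁ u) (proj₁ v))
  Dcard≡evalWeights i j u v u~v = trans (Dcard≡sum G i j u v) (sum-dist≡evalWeights (layerIndicator i j) u v u~v)

  distToSet-W≡evalWeights : ∀ u v → Adjacent G u v →
    distToSet G u (W G u v) ≡ evalWeights k′ l′ (weights closerDist (proj₁ u) (proj₁ v))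
  distToSet-W≡evalWeights u v u~v = trans (distToSet-W≡sum G dist-sym u v) (sum-dist≡evalWeights closerDist u v u~v)

  Dcard-beyond-diameter : ∀ i j u v → 3 < i ⊎ 3 < j → Dcard G i j u v ≡ 0
  Dcard-beyond-diameter i j u v (inj₁ 3<i) =
    Dcard≡0 G i j u v λ x (ux≡i , _) → <⇒≱ 3<i (subst (_≤ 3) ux≡i (dist≤3 u x))
  Dcard-beyond-diameter i j u v (inj₂ 3<j) =
    Dcard≡0 G i j u v λ x (_ , vx≡j) → <⇒≱ 3<j (subst (_≤ 3) vx≡j (dist≤3 v x))

  W-balanced : ∀ u v → Adjacent G u v → distToSet G u (W G u v) ≡ distToSet G v (W G v u)
  W-balanced u v u~v = begin
    distToSet G u (W G u v)                                    ≡⟨ distToSet-W≡evalWeights u v u~v ⟩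
    evalWeights k′ l′ (weights closerDist (proj₁ u) (proj₁ v))
      ≡⟨ cong (evalWeights k′ l′) (closerWeights-sym (proj₁ u) (proj₁ v) u~v) ⟩
    evalWeights k′ l′ (weights closerDist (proj₁ v) (proj₁ u)) ≡⟨ distToSet-W≡evalWeights v u v~u ⟨
    distToSet G v (W G v u)                                    ∎
    where
    open ≡-Reasoning
    v~u : Adjacent G v u
    v~u = trans (cycleAdj-sym (proj₁ v) (proj₁ u)) u~v

strongly-balanced⇒k≡l : ∀ k′ l′ → StronglyDistanceBalanced (C6 (suc k′) (suc l′)) → k′ ≡ l′
strongly-balanced⇒k≡l k′ l′ sdb =
  *-cancelˡ-≡ k′ l′ 2 (trans (sym (+-identityʳ (2 * k′))) (suc-injective (begin
  1 + 2 * k′ + 0 * l′  ≡⟨ Dcard≡evalWeights 2 1 x₀ x₁ refl ⟨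
  Dcard G 2 1 x₀ x₁    ≡⟨ sdb 2 (s≤s z≤n) x₀ x₁ refl ⟩
  Dcard G 1 2 x₀ x₁    ≡⟨ Dcard≡evalWeights 1 2 x₀ x₁ refl ⟩
  1 + 0 * k′ + 2 * l′  ∎)))
  where
  open ≡-Reasoning
  open Blowup k′ l′
  x₀ x₁ : C6V (suc k′) (suc l′)
  x₀ = 0F , zero
  x₁ = 1F , zero

C6-strongly-balanced : ∀ k′ → StronglyDistanceBalanced (C6 (suc k′) (suc k′))
C6-strongly-balanced k′ = balanced
  where
  open Blowup k′ k′

  balancedAt : ∀ i → LayersBalancedAt i → ∀ u v → Adjacent G u v →
               Dcard G i (i ∸ 1) u v ≡ Dcard G (i ∸ 1) i u v
  balancedAt i bal u v u~v = begin
    Dcard G i (i ∸ 1) u v   ≡⟨ Dcard≡evalWeights i (i ∸ 1) u v u~v ⟩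
    evalWeights k′ k′ w     ≡⟨ diagonal-≡⇒evalWeights-≡ k′ w w′ (bal (proj₁ u) (proj₁ v) u~v) ⟩
    evalWeights k′ k′ w′    ≡⟨ Dcard≡evalWeights (i ∸ 1) i u v u~v ⟨
    Dcard G (i ∸ 1) i u v   ∎
    where
    open ≡-Reasoning
    w w′ : Weights
    w  = weights (layerIndicator i (i ∸ 1)) (proj₁ u) (proj₁ v)
    w′ = weights (layerIndicator (i ∸ 1) i) (proj₁ u) (proj₁ v)

  balanced : StronglyDistanceBalanced G
  balanced 0 ()
  balanced 1 _ = balancedAt 1 (layersBalanced 1F)
  balanced 2 _ = balancedAt 2 (layersBalanced 2F)
  balanced 3 _ = balancedAt 3 (layersBalanced 3F)
  balanced (suc (suc (suc (suc i)))) _ u v _ = trans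
    (Dcard-beyond-diameter _ _ u v (inj₁ (s≤s (s≤s (s≤s (s≤s z≤n))))))
    (sym (Dcard-beyond-diameter _ _ u v (inj₂ (s≤s (s≤s (s≤s (s≤s z≤n)))))))

proposition4p2 : (k l : ℕ) → 1 ≤ k → 1 ≤ l →
    (StronglyDistanceBalanced (C6 k l) ⇔ k ≡ l)
    × (∀ (u v : FinGraph.V (C6 k l)) → Adjacent (C6 k l) u v →
         distToSet (C6 k l) u (W (C6 k l) u v) ≡ distToSet (C6 k l) v (W (C6 k l) v u))
proposition4p2 (suc k′) (suc l′) _ _ =
  mk⇔ (λ sdb → cong suc (strongly-balanced⇒k≡l k′ l′ sdb)) (λ { refl → C6-strongly-balanced k′ }) ,
  Blowup.W-balanced k′ l′
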